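{- Let $e\in\mathbb{N}$, $q:=2^e$, and let $\mathcal{D}=(D,Q)$ be a discriminant form whose underlying group is isomorphic to $(\mathbb{Z}/q\mathbb{Z})^n$, where $n\geq7$ if $e\in\{1,2\}$ and $n\geq3$ if $e\geq3$. Then $D$ contains two isotropic, mutually orthogonal elements $\delta,\mu$ that are $\mathbb{Z}/2\mathbb{Z}$- or $\mathbb{Z}/q\mathbb{Z}$-linearly independent, i.e. $a\delta+b\mu=0$ with $a,b\in\mathbb{Z}$ implies $a\equiv b\equiv0\pmod 2$ (respectively $\pmod q$).
   Context: A discriminant form $\mathcal{D}=(D,Q)$ is a finite abelian group $D$ with $Q:D\to\mathbb{Q}/\mathbb{Z}$ satisfying $Q(a\gamma)=a^2Q(\gamma)$ for $a\in\mathbb{Z}$, such that $(\gamma,\delta)=Q(\gamma+\delta)-Q(\gamma)-Q(\delta)$ is a nondegenerate $\mathbb{Z}$-bilinear form. An element $\delta$ is isotropic if $Q(\delta)=0+\mathbb{Z}$; $\delta,\mu$ are orthogonal if $(\delta,\mu)=0+\mathbb{Z}$. -}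

module Defs where

open import Data.Nat using (ℕ)
open import Data.Fin using (Fin)
open import Data.Integer as ℤ using (ℤ)
open import Data.Integer.Divisibility using () renaming (_∣_ to _∣ℤ_)
open import Data.Rational as ℚ using (ℚ; _/_)
open import Data.Product using (∃)
open import Relation.Binary.PropositionalEquality using (_≡_)

_≡ℚ/ℤ_ : ℚ → ℚ → Set
x ≡ℚ/ℤ y = ∃ λ (k : ℤ) → x ℚ.- y ≡ k / 1

-- The group (ℤ/qℤ)^n, elements represented by integer vectors Fin n → ℤ,
-- with equality componentwise modulo q.
Vecℤ : ℕ → Set
Vecℤ n = Fin n → ℤ

_≈[_]_ : {n : ℕ} → Vecℤ n → ℕ → Vecℤ n → Set
γ ≈[ q ] γ' = ∀ i → ℤ.+ q ∣ℤ (γ i ℤ.- γ' i)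

_⊕_ : {n : ℕ} → Vecℤ n → Vecℤ n → Vecℤ n
(γ ⊕ δ) i = γ i ℤ.+ δ i

_·_ : {n : ℕ} → ℤ → Vecℤ n → Vecℤ n
(a · γ) i = a ℤ.* γ i

𝟘 : {n : ℕ} → Vecℤ n
𝟘 _ = ℤ.0ℤ

bil : {n : ℕ} → (Vecℤ n → ℚ) → Vecℤ n → Vecℤ n → ℚ
bil Q γ δ = (Q (γ ⊕ δ) ℚ.- Q γ) ℚ.- Q δ

record IsDiscriminantForm (q n : ℕ) (Q : Vecℤ n → ℚ) : Set where
  field
    well-defined : ∀ γ γ' → γ ≈[ q ] γ' → Q γ ≡ℚ/ℤ Q γ'
    quadratic    : ∀ (a : ℤ) γ → Q (a · γ) ≡ℚ/ℤ ((a ℤ.* a) / 1 ℚ.* Q γ)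
    bilinearˡ    : ∀ γ γ' δ → bil Q (γ ⊕ γ') δ ≡ℚ/ℤ (bil Q γ δ ℚ.+ bil Q γ' δ)
    bilinearʳ    : ∀ γ δ δ' → bil Q γ (δ ⊕ δ') ≡ℚ/ℤ (bil Q γ δ ℚ.+ bil Q γ δ')
    nondegenerate : ∀ γ → (∀ δ → bil Q γ δ ≡ℚ/ℤ ℚ.0ℚ) → γ ≈[ q ] 𝟘

LinIndepMod : {n : ℕ} → ℕ → ℕ → Vecℤ n → Vecℤ n → Set
LinIndepMod q m δ μ =
  ∀ (a b : ℤ) → ((a · δ) ⊕ (b · μ)) ≈[ q ] 𝟘 → (ℤ.+ m ∣ℤ a) Data.Product.× (ℤ.+ m ∣ℤ b)

-- Two facts drive everything: 2q·Q(γ) ≡ 0 and q·(γ, δ) ≡ 0, since (qγ, δ) = (0, δ) and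
-- 4Q(γ) = Q(2γ) = 2Q(γ) + (γ, γ).  Write q = 2s.  If 8 ∣ q then s² is a multiple of 2q,
-- so s·εᵢ and s·εⱼ are already isotropic and orthogonal.  Otherwise pass to the elements
-- s·x, x ∈ {0,1}ⁿ: there 4Q and 2(·,·) vanish, so Q becomes a ℤ/4-valued quadratic form
-- on 𝔽₂ⁿ whose polar form takes values in {0, 2}.  Among four independent vectors one finds a
-- nonzero isotropic sum: if one of them is odd, add it to the other odd ones; three even
-- vectors are then a finite case check.  This gives δ, nonzero at some coordinate i; the
-- same step, applied to five unit vectors avoiding i after making them orthogonal to δ
-- in the same way, gives μ.  Coordinates i and a coordinate of μ witness independence
-- mod 2.  For q = 1 the group is trivial.

module Submission where

open import Defs
open import Data.Nat using (ℕ; _^_; _≤_; suc)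
open import Data.Rational using (ℚ; 0ℚ)
open import Data.Product using (∃₂; _×_)
open import Data.Sum using (_⊎_)
open import Relation.Binary.PropositionalEquality using (_≡_)

open import Data.Bool using (Bool; true; false; _xor_; if_then_else_)
import Data.Bool.Properties as Boolₚ
open import Data.Empty using (⊥-elim)
open import Data.Fin as Fin using (Fin; zero; suc; punchIn; inject₁; inject≤)
import Data.Fin.Properties as Finₚ
open import Data.Integer as ℤ using (ℤ; +_; -[1+_]; 0ℤ)
import Data.Integer.Properties as ℤₚ
open import Data.Integer.Divisibility using () renaming (_∣_ to _∣ℤ_)
import Data.Integer.Divisibility.Signed as ℤ∣
open import Data.Integer.DivMod using (n%ℕd<d; a≡a%ℕn+[a/ℕn]*n)
open import Data.Integer.Tactic.RingSolver using (solve-∀)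
open import Data.Nat.Tactic.RingSolver using () renaming (solve-∀ to ℕ-solve-∀)
import Data.Nat as ℕ
import Data.Nat.Divisibility as ℕ∣
import Data.Nat.Properties as ℕₚ
open import Data.Product using (Σ; ∃; _,_; proj₁; proj₂)
open import Data.Rational as ℚ using (_/_; 1ℚ; _+_; _-_; -_; _*_)
import Data.Rational.Properties as ℚₚ
open import Data.Rational.Solver using (module +-*-Solver)
open +-*-Solver using (solve; _:=_; _:+_; _:*_; _:-_; :-_; con)
import Data.Rational.Unnormalised as ℚᵘ
import Data.Rational.Unnormalised.Properties as ℚᵘₚ
open import Data.Sum using (inj₁; inj₂)
open import Data.Unit using (⊤; tt)
open import Level using (0ℓ)
open import Relation.Binary.Bundles using (Setoid)
open import Relation.Binary.Structures using (IsEquivalence)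
open import Relation.Binary.PropositionalEquality using (refl; sym; trans; cong; cong₂; subst; module ≡-Reasoning)
open import Relation.Nullary using (¬_; Dec; does; yes; no)
open import Relation.Nullary.Decidable using (from-no; dec-true; dec-false)
open import Function using (_∘_)
import Relation.Binary.Reasoning.Setoid

ι : ℤ → ℚ
ι k = k / 1

toℚᵘ-ι : ∀ k → ℚ.toℚᵘ (ι k) ℚᵘ.≃ ℚᵘ.mkℚᵘ k 0
toℚᵘ-ι k = ℚₚ.toℚᵘ-fromℚᵘ (ℚᵘ.mkℚᵘ k 0)

ι-+ : ∀ a b → ι (a ℤ.+ b) ≡ ι a + ι b
ι-+ a b = ℚₚ.toℚᵘ-injective (begin
  ℚ.toℚᵘ (ι (a ℤ.+ b))                   ≈⟨ toℚᵘ-ι (a ℤ.+ b) ⟩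
  ℚᵘ.mkℚᵘ (a ℤ.+ b) 0                    ≈⟨ ℚᵘ.*≡* (denominators a b) ⟩
  ℚᵘ.mkℚᵘ a 0 ℚᵘ.+ ℚᵘ.mkℚᵘ b 0           ≈⟨ ℚᵘₚ.+-cong (toℚᵘ-ι a) (toℚᵘ-ι b) ⟨
  ℚ.toℚᵘ (ι a) ℚᵘ.+ ℚ.toℚᵘ (ι b)         ≈⟨ ℚₚ.toℚᵘ-homo-+ (ι a) (ι b) ⟨
  ℚ.toℚᵘ (ι a + ι b)                     ∎)
  where
  open ℚᵘₚ.≃-Reasoning
  denominators : ∀ a b → (a ℤ.+ b) ℤ.* + 1 ≡ (a ℤ.* + 1 ℤ.+ b ℤ.* + 1) ℤ.* + 1
  denominators = solve-∀

ι-* : ∀ a b → ι (a ℤ.* b) ≡ ι a * ι b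
ι-* a b = ℚₚ.toℚᵘ-injective (begin
  ℚ.toℚᵘ (ι (a ℤ.* b))                   ≈⟨ toℚᵘ-ι (a ℤ.* b) ⟩
  ℚᵘ.mkℚᵘ (a ℤ.* b) 0                    ≈⟨ ℚᵘ.*≡* refl ⟩
  ℚᵘ.mkℚᵘ a 0 ℚᵘ.* ℚᵘ.mkℚᵘ b 0           ≈⟨ ℚᵘₚ.*-cong (toℚᵘ-ι a) (toℚᵘ-ι b) ⟨
  ℚ.toℚᵘ (ι a) ℚᵘ.* ℚ.toℚᵘ (ι b)         ≈⟨ ℚₚ.toℚᵘ-homo-* (ι a) (ι b) ⟨
  ℚ.toℚᵘ (ι a * ι b)                     ∎)
  where open ℚᵘₚ.≃-Reasoning

ι-neg : ∀ a → ι (ℤ.- a) ≡ - ι a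
ι-neg a = ℚₚ.toℚᵘ-injective (begin
  ℚ.toℚᵘ (ι (ℤ.- a))                     ≈⟨ toℚᵘ-ι (ℤ.- a) ⟩
  ℚᵘ.mkℚᵘ (ℤ.- a) 0                      ≈⟨ ℚᵘ.*≡* refl ⟩
  ℚᵘ.- ℚᵘ.mkℚᵘ a 0                       ≈⟨ ℚᵘₚ.-‿cong (toℚᵘ-ι a) ⟨
  ℚᵘ.- ℚ.toℚᵘ (ι a)                      ≈⟨ ℚₚ.toℚᵘ-homo‿- (ι a) ⟨
  ℚ.toℚᵘ (- ι a)                         ∎)
  where open ℚᵘₚ.≃-Reasoning

ι-injective : ∀ {a b} → ι a ≡ ι b → a ≡ b
ι-injective {a} {b} eq
  with ℚᵘₚ.≃-trans (ℚᵘₚ.≃-sym (toℚᵘ-ι a)) (ℚᵘₚ.≃-trans (ℚₚ.toℚᵘ-cong eq) (toℚᵘ-ι b))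
... | ℚᵘ.*≡* cross = trans (sym (ℤₚ.*-identityʳ a)) (trans cross (ℤₚ.*-identityʳ b))

ι-pos-* : ∀ m n → ι (+ (m ℕ.* n)) ≡ ι (+ m) * ι (+ n)
ι-pos-* m n = trans (cong ι (ℤₚ.pos-* m n)) (ι-* (+ m) (+ n))

infix 4 _≈_

-- A wrapper around _≡ℚ/ℤ_, which unfolds to an existential from which Agda
-- cannot infer the two sides.
record _≈_ (x y : ℚ) : Set where
  constructor mk≈
  field integral-difference : x ≡ℚ/ℤ y
open _≈_ public

≈-reflexive : ∀ {x y} → x ≡ y → x ≈ y
≈-reflexive {x} refl = mk≈ (0ℤ , ℚₚ.+-inverseʳ x)

≈-refl : ∀ {x} → x ≈ x
≈-refl = ≈-reflexive refl

≈-sym : ∀ {x y} → x ≈ y → y ≈ x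
≈-sym {x} {y} (mk≈ (k , eq)) = mk≈ (ℤ.- k , (begin
  y - x        ≡⟨ flip x y ⟩
  - (x - y)    ≡⟨ cong -_ eq ⟩
  - ι k        ≡⟨ sym (ι-neg k) ⟩
  ι (ℤ.- k)    ∎))
  where
  open ≡-Reasoning
  flip : ∀ x y → y - x ≡ - (x - y)
  flip = solve 2 (λ x y → y :- x := :- (x :- y)) refl

≈-trans : ∀ {x y z} → x ≈ y → y ≈ z → x ≈ z
≈-trans {x} {y} {z} (mk≈ (k , eq₁)) (mk≈ (l , eq₂)) = mk≈ (k ℤ.+ l , (begin
  x - z                  ≡⟨ split x y z ⟩
  (x - y) + (y - z)      ≡⟨ cong₂ _+_ eq₁ eq₂ ⟩
  ι k + ι l              ≡⟨ sym (ι-+ k l) ⟩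
  ι (k ℤ.+ l)            ∎))
  where
  open ≡-Reasoning
  split : ∀ x y z → x - z ≡ (x - y) + (y - z)
  split = solve 3 (λ x y z → x :- z := (x :- y) :+ (y :- z)) refl

≈-isEquivalence : IsEquivalence _≈_
≈-isEquivalence = record { refl = ≈-refl ; sym = ≈-sym ; trans = ≈-trans }

ℚ/ℤ-setoid : Setoid 0ℓ 0ℓ
ℚ/ℤ-setoid = record { isEquivalence = ≈-isEquivalence }

module ≈-Reasoning = Relation.Binary.Reasoning.Setoid ℚ/ℤ-setoid

+-cong : ∀ {x y u v} → x ≈ y → u ≈ v → x + u ≈ y + v
+-cong {x} {y} {u} {v} (mk≈ (k , eq₁)) (mk≈ (l , eq₂)) = mk≈ (k ℤ.+ l , (begin
  (x + u) - (y + v)      ≡⟨ regroup x y u v ⟩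
  (x - y) + (u - v)      ≡⟨ cong₂ _+_ eq₁ eq₂ ⟩
  ι k + ι l              ≡⟨ sym (ι-+ k l) ⟩
  ι (k ℤ.+ l)            ∎))
  where
  open ≡-Reasoning
  regroup : ∀ x y u v → (x + u) - (y + v) ≡ (x - y) + (u - v)
  regroup = solve 4 (λ x y u v → (x :+ u) :- (y :+ v) := (x :- y) :+ (u :- v)) refl

neg-cong : ∀ {x y} → x ≈ y → - x ≈ - y
neg-cong {x} {y} (mk≈ (k , eq)) = mk≈ (ℤ.- k , (begin
  - x - - y              ≡⟨ negate x y ⟩
  - (x - y)              ≡⟨ cong -_ eq ⟩
  - ι k                  ≡⟨ sym (ι-neg k) ⟩
  ι (ℤ.- k)              ∎))
  where
  open ≡-Reasoning
  negate : ∀ x y → - x - - y ≡ - (x - y)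
  negate = solve 2 (λ x y → (:- x) :- (:- y) := :- (x :- y)) refl

-‿cong : ∀ {x y u v} → x ≈ y → u ≈ v → x - u ≈ y - v
-‿cong x≈y u≈v = +-cong x≈y (neg-cong u≈v)

ι*-congˡ : ∀ a {x y} → x ≈ y → ι a * x ≈ ι a * y
ι*-congˡ a {x} {y} (mk≈ (k , eq)) = mk≈ (a ℤ.* k , (begin
  ι a * x - ι a * y      ≡⟨ factor (ι a) x y ⟩
  ι a * (x - y)          ≡⟨ cong (ι a *_) eq ⟩
  ι a * ι k              ≡⟨ sym (ι-* a k) ⟩
  ι (a ℤ.* k)            ∎))
  where
  open ≡-Reasoning
  factor : ∀ c x y → c * x - c * y ≡ c * (x - y)
  factor = solve 3 (λ c x y → c :* x :- c :* y := c :* (x :- y)) refl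

ι*-annihilates : ∀ a {x} → x ≈ 0ℚ → ι a * x ≈ 0ℚ
ι*-annihilates a x≈0 = ≈-trans (ι*-congˡ a x≈0) (≈-reflexive (ℚₚ.*-zeroʳ (ι a)))

≈-double⇒≈0 : ∀ {x} → x ≈ x + x → x ≈ 0ℚ
≈-double⇒≈0 {x} (mk≈ (k , eq)) = mk≈ (ℤ.- k , (begin
  x - 0ℚ                 ≡⟨ cancel x ⟩
  - (x - (x + x))        ≡⟨ cong -_ eq ⟩
  - ι k                  ≡⟨ sym (ι-neg k) ⟩
  ι (ℤ.- k)              ∎))
  where
  open ≡-Reasoning
  cancel : ∀ x → x - 0ℚ ≡ - (x - (x + x))
  cancel = solve 1 (λ x → x :- con 0ℚ := :- (x :- (x :+ x))) refl

data ℤ₄ : Set where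
  0₄ 1₄ 2₄ 3₄ : ℤ₄

infixl 6 _+₄_
_+₄_ : ℤ₄ → ℤ₄ → ℤ₄
0₄ +₄ d  = d
1₄ +₄ 0₄ = 1₄
1₄ +₄ 1₄ = 2₄
1₄ +₄ 2₄ = 3₄
1₄ +₄ 3₄ = 0₄
2₄ +₄ 0₄ = 2₄
2₄ +₄ 1₄ = 3₄
2₄ +₄ 2₄ = 0₄
2₄ +₄ 3₄ = 1₄
3₄ +₄ 0₄ = 3₄
3₄ +₄ 1₄ = 0₄
3₄ +₄ 2₄ = 1₄
3₄ +₄ 3₄ = 2₄

toℕ₄ : ℤ₄ → ℕ
toℕ₄ 0₄ = 0
toℕ₄ 1₄ = 1
toℕ₄ 2₄ = 2
toℕ₄ 3₄ = 3

Even₄ : ℤ₄ → Set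
Even₄ c = c ≡ 0₄ ⊎ c ≡ 2₄

even₄? : ∀ c → Dec (Even₄ c)
even₄? 0₄ = yes (inj₁ refl)
even₄? 1₄ = no λ { (inj₁ ()) ; (inj₂ ()) }
even₄? 2₄ = yes (inj₂ refl)
even₄? 3₄ = no λ { (inj₁ ()) ; (inj₂ ()) }

≟0₄ : ∀ c → Dec (c ≡ 0₄)
≟0₄ 0₄ = yes refl
≟0₄ 1₄ = no λ ()
≟0₄ 2₄ = no λ ()
≟0₄ 3₄ = no λ ()

c+c≡0⇒even : ∀ c → c +₄ c ≡ 0₄ → Even₄ c
c+c≡0⇒even 0₄ _ = inj₁ refl
c+c≡0⇒even 2₄ _ = inj₂ refl

odd+odd+even : ∀ c d b → ¬ Even₄ c → ¬ Even₄ d → Even₄ b → Even₄ (c +₄ d +₄ b)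
odd+odd+even 0₄ _  _ c-odd _ _ = ⊥-elim (c-odd (inj₁ refl))
odd+odd+even 2₄ _  _ c-odd _ _ = ⊥-elim (c-odd (inj₂ refl))
odd+odd+even _  0₄ _ _ d-odd _ = ⊥-elim (d-odd (inj₁ refl))
odd+odd+even _  2₄ _ _ d-odd _ = ⊥-elim (d-odd (inj₂ refl))
odd+odd+even 1₄ 1₄ _ _ _ (inj₁ refl) = inj₂ refl
odd+odd+even 1₄ 3₄ _ _ _ (inj₁ refl) = inj₁ refl
odd+odd+even 3₄ 1₄ _ _ _ (inj₁ refl) = inj₁ refl
odd+odd+even 3₄ 3₄ _ _ _ (inj₁ refl) = inj₂ refl
odd+odd+even 1₄ 1₄ _ _ _ (inj₂ refl) = inj₁ refl
odd+odd+even 1₄ 3₄ _ _ _ (inj₂ refl) = inj₂ refl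
odd+odd+even 3₄ 1₄ _ _ _ (inj₂ refl) = inj₂ refl
odd+odd+even 3₄ 3₄ _ _ _ (inj₂ refl) = inj₁ refl

four-times-non-integral : ∀ {x y} m → ι (+ 4) * (x - y) ≡ ι m → ¬ 4 ℕ∣.∣ ℤ.∣ m ∣ → ¬ x ≈ y
four-times-non-integral {x} {y} m eq 4∤m (mk≈ (k , x-y≡k)) =
  4∤m (subst (λ z → 4 ℕ∣.∣ ℤ.∣ z ∣) (sym m≡4k) 4∣4k)
  where
  m≡4k : m ≡ + 4 ℤ.* k
  m≡4k = ι-injective (trans (sym eq) (trans (cong (ι (+ 4) *_) x-y≡k) (sym (ι-* (+ 4) k))))
  4∣4k : 4 ℕ∣.∣ ℤ.∣ + 4 ℤ.* k ∣
  4∣4k = subst (4 ℕ∣.∣_) (sym (ℤₚ.abs-* (+ 4) k)) (ℕ∣.m∣m*n ℤ.∣ k ∣)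

-- Opaque: otherwise comparing quarters (f x) with quarters (g x) unfolds the
-- normalisation of rationals and exhausts memory.
opaque
  quarters : ℤ₄ → ℚ
  quarters c = + toℕ₄ c / 4

  quarters-0₄ : quarters 0₄ ≡ 0ℚ
  quarters-0₄ = refl

  quarters-+ : ∀ c d → quarters (c +₄ d) ≈ quarters c + quarters d
  quarters-+ 0₄ 0₄ = mk≈ (0ℤ , refl)
  quarters-+ 0₄ 1₄ = mk≈ (0ℤ , refl)
  quarters-+ 0₄ 2₄ = mk≈ (0ℤ , refl)
  quarters-+ 0₄ 3₄ = mk≈ (0ℤ , refl)
  quarters-+ 1₄ 0₄ = mk≈ (0ℤ , refl)
  quarters-+ 1₄ 1₄ = mk≈ (0ℤ , refl)
  quarters-+ 1₄ 2₄ = mk≈ (0ℤ , refl)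
  quarters-+ 1₄ 3₄ = mk≈ (-[1+ 0 ] , refl)
  quarters-+ 2₄ 0₄ = mk≈ (0ℤ , refl)
  quarters-+ 2₄ 1₄ = mk≈ (0ℤ , refl)
  quarters-+ 2₄ 2₄ = mk≈ (-[1+ 0 ] , refl)
  quarters-+ 2₄ 3₄ = mk≈ (-[1+ 0 ] , refl)
  quarters-+ 3₄ 0₄ = mk≈ (0ℤ , refl)
  quarters-+ 3₄ 1₄ = mk≈ (-[1+ 0 ] , refl)
  quarters-+ 3₄ 2₄ = mk≈ (-[1+ 0 ] , refl)
  quarters-+ 3₄ 3₄ = mk≈ (-[1+ 0 ] , refl)

  quarters-injective : ∀ c d → quarters c ≈ quarters d → c ≡ d
  quarters-injective 0₄ 0₄ _ = refl
  quarters-injective 1₄ 1₄ _ = refl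
  quarters-injective 2₄ 2₄ _ = refl
  quarters-injective 3₄ 3₄ _ = refl
  quarters-injective 0₄ 1₄ h = ⊥-elim (four-times-non-integral (ℤ.- + 1) refl (from-no (4 ℕ∣.∣? 1)) h)
  quarters-injective 0₄ 2₄ h = ⊥-elim (four-times-non-integral (ℤ.- + 2) refl (from-no (4 ℕ∣.∣? 2)) h)
  quarters-injective 0₄ 3₄ h = ⊥-elim (four-times-non-integral (ℤ.- + 3) refl (from-no (4 ℕ∣.∣? 3)) h)
  quarters-injective 1₄ 0₄ h = ⊥-elim (four-times-non-integral (+ 1) refl (from-no (4 ℕ∣.∣? 1)) h)
  quarters-injective 1₄ 2₄ h = ⊥-elim (four-times-non-integral (ℤ.- + 1) refl (from-no (4 ℕ∣.∣? 1)) h)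
  quarters-injective 1₄ 3₄ h = ⊥-elim (four-times-non-integral (ℤ.- + 2) refl (from-no (4 ℕ∣.∣? 2)) h)
  quarters-injective 2₄ 0₄ h = ⊥-elim (four-times-non-integral (+ 2) refl (from-no (4 ℕ∣.∣? 2)) h)
  quarters-injective 2₄ 1₄ h = ⊥-elim (four-times-non-integral (+ 1) refl (from-no (4 ℕ∣.∣? 1)) h)
  quarters-injective 2₄ 3₄ h = ⊥-elim (four-times-non-integral (ℤ.- + 1) refl (from-no (4 ℕ∣.∣? 1)) h)
  quarters-injective 3₄ 0₄ h = ⊥-elim (four-times-non-integral (+ 3) refl (from-no (4 ℕ∣.∣? 3)) h)
  quarters-injective 3₄ 1₄ h = ⊥-elim (four-times-non-integral (+ 2) refl (from-no (4 ℕ∣.∣? 2)) h)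
  quarters-injective 3₄ 2₄ h = ⊥-elim (four-times-non-integral (+ 1) refl (from-no (4 ℕ∣.∣? 1)) h)

  quarter-class : ∀ x → ι (+ 4) * x ≈ 0ℚ → Σ ℤ₄ λ c → x ≈ quarters c
  quarter-class x (mk≈ (k , 4x≡k)) = classify (k ℤ.%ℕ 4) (n%ℕd<d k 4) (a≡a%ℕn+[a/ℕn]*n k 4)
    where
    open ≡-Reasoning
    ¼ : ℚ
    ¼ = + 1 / 4
    t : ℤ
    t = k ℤ./ℕ 4
    quarter-of-4x : ∀ x r → x - r * ¼ ≡ ¼ * (ι (+ 4) * x - 0ℚ) - r * ¼
    quarter-of-4x = solve 2 (λ x r → x :- r :* con ¼ := con ¼ :* (con (ι (+ 4)) :* x :- con 0ℚ) :- r :* con ¼) refl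
    quarter-of-4t : ∀ r t → ¼ * (r + t * ι (+ 4)) - r * ¼ ≡ t
    quarter-of-4t = solve 2 (λ r t → con ¼ :* (r :+ t :* con (ι (+ 4))) :- r :* con ¼ := t) refl
    residue : ∀ c → k ≡ + toℕ₄ c ℤ.+ t ℤ.* + 4 → quarters c ≡ ι (+ toℕ₄ c) * ¼ → x ≈ quarters c
    residue c k≡r+4t quarters-c = mk≈ (t , (begin
      x - quarters c                         ≡⟨ cong (λ z → x - z) quarters-c ⟩
      x - r * ¼                              ≡⟨ quarter-of-4x x r ⟩
      ¼ * (ι (+ 4) * x - 0ℚ) - r * ¼         ≡⟨ cong (λ z → ¼ * z - r * ¼) 4x≡k ⟩
      ¼ * ι k - r * ¼                        ≡⟨ cong (λ z → ¼ * ι z - r * ¼) k≡r+4t ⟩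
      ¼ * ι (+ toℕ₄ c ℤ.+ t ℤ.* + 4) - r * ¼ ≡⟨ cong (λ z → ¼ * z - r * ¼) ι-r+4t ⟩
      ¼ * (r + ι t * ι (+ 4)) - r * ¼        ≡⟨ quarter-of-4t r (ι t) ⟩
      ι t                                    ∎))
      where
      r : ℚ
      r = ι (+ toℕ₄ c)
      ι-r+4t : ι (+ toℕ₄ c ℤ.+ t ℤ.* + 4) ≡ r + ι t * ι (+ 4)
      ι-r+4t = trans (ι-+ (+ toℕ₄ c) (t ℤ.* + 4)) (cong (λ z → r + z) (ι-* t (+ 4)))
    classify : ∀ m → m ℕ.< 4 → k ≡ + m ℤ.+ t ℤ.* + 4 → Σ ℤ₄ λ c → x ≈ quarters c
    classify 0 _ eq = 0₄ , residue 0₄ eq refl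
    classify 1 _ eq = 1₄ , residue 1₄ eq refl
    classify 2 _ eq = 2₄ , residue 2₄ eq refl
    classify 3 _ eq = 3₄ , residue 3₄ eq refl
    classify (ℕ.suc (ℕ.suc (ℕ.suc (ℕ.suc _)))) (ℕ.s≤s (ℕ.s≤s (ℕ.s≤s (ℕ.s≤s ())))) _

≈[]-reflexive : ∀ {n} q {γ γ' : Vecℤ n} → (∀ i → γ i ≡ γ' i) → γ ≈[ q ] γ'
≈[]-reflexive q {γ} {γ'} eq i =
  subst (+ q ∣ℤ_) (sym (trans (cong (ℤ._- γ' i) (eq i)) (ℤₚ.+-inverseʳ (γ' i)))) (q ℕ∣.∣0)

Q-⊕ : ∀ {n} (Q : Vecℤ n → ℚ) γ δ → Q (γ ⊕ δ) ≡ Q γ + Q δ + bil Q γ δ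
Q-⊕ Q γ δ = expand (Q (γ ⊕ δ)) (Q γ) (Q δ)
  where
  expand : ∀ a b c → a ≡ b + c + ((a - b) - c)
  expand = solve 3 (λ a b c → a := b :+ c :+ ((a :- b) :- c)) refl

ι-square-annihilates : ∀ {x} c a {m} → m ℕ∣.∣ c ℕ.* (a ℕ.* a) → ι (+ m) * x ≈ 0ℚ →
                       ι (+ c) * (ι (+ a ℤ.* + a) * x) ≈ 0ℚ
ι-square-annihilates {x} c a {m} (ℕ∣.divides k ca²≡km) mx≈0 = ≈-trans (≈-reflexive (begin
  ι (+ c) * (ι (+ a ℤ.* + a) * x)     ≡⟨ cong (λ z → ι (+ c) * (ι z * x)) (sym (ℤₚ.pos-* a a)) ⟩
  ι (+ c) * (ι (+ (a ℕ.* a)) * x)     ≡⟨ sym (ℚₚ.*-assoc (ι (+ c)) _ x) ⟩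
  ι (+ c) * ι (+ (a ℕ.* a)) * x       ≡⟨ cong (_* x) (sym (ι-pos-* c (a ℕ.* a))) ⟩
  ι (+ (c ℕ.* (a ℕ.* a))) * x         ≡⟨ cong (λ z → ι (+ z) * x) ca²≡km ⟩
  ι (+ (k ℕ.* m)) * x                 ≡⟨ cong (_* x) (ι-pos-* k m) ⟩
  ι (+ k) * ι (+ m) * x               ≡⟨ ℚₚ.*-assoc (ι (+ k)) (ι (+ m)) x ⟩
  ι (+ k) * (ι (+ m) * x)             ∎)) (ι*-annihilates (+ k) mx≈0)
  where open ≡-Reasoning

module DiscriminantForm {q n : ℕ} {Q : Vecℤ n → ℚ} (D : IsDiscriminantForm q n Q) where
  open IsDiscriminantForm D
  open ≈-Reasoning

  Q-resp : ∀ {γ γ'} → γ ≈[ q ] γ' → Q γ ≈ Q γ'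
  Q-resp {γ} {γ'} h = mk≈ (well-defined γ γ' h)

  Q-cong : ∀ {γ γ'} → (∀ i → γ i ≡ γ' i) → Q γ ≈ Q γ'
  Q-cong eq = Q-resp (≈[]-reflexive q eq)

  Q-quadratic : ∀ a γ → Q (a · γ) ≈ ι (a ℤ.* a) * Q γ
  Q-quadratic a γ = mk≈ (quadratic a γ)

  bil-additiveˡ : ∀ γ γ' δ → bil Q (γ ⊕ γ') δ ≈ bil Q γ δ + bil Q γ' δ
  bil-additiveˡ γ γ' δ = mk≈ (bilinearˡ γ γ' δ)

  Q-𝟘 : Q 𝟘 ≈ 0ℚ
  Q-𝟘 = ≈-trans (Q-quadratic 0ℤ 𝟘) (≈-reflexive (ℚₚ.*-zeroˡ (Q 𝟘)))

  bil-𝟘ˡ : ∀ δ → bil Q 𝟘 δ ≈ 0ℚ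
  bil-𝟘ˡ δ = ≈-double⇒≈0 (bil-additiveˡ 𝟘 𝟘 δ)

  bil-respˡ : ∀ {γ γ'} δ → γ ≈[ q ] γ' → bil Q γ δ ≈ bil Q γ' δ
  bil-respˡ {γ} {γ'} δ γ≈γ' = -‿cong (-‿cong (Q-resp γ+δ≈γ'+δ) (Q-resp γ≈γ')) ≈-refl
    where
    cancel : ∀ a b c → (a ℤ.+ c) ℤ.- (b ℤ.+ c) ≡ a ℤ.- b
    cancel = solve-∀
    γ+δ≈γ'+δ : (γ ⊕ δ) ≈[ q ] (γ' ⊕ δ)
    γ+δ≈γ'+δ i = subst (+ q ∣ℤ_) (sym (cancel (γ i) (γ' i) (δ i))) (γ≈γ' i)

  bil-sym : ∀ γ δ → bil Q γ δ ≈ bil Q δ γ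
  bil-sym γ δ = begin
    Q (γ ⊕ δ) - Q γ - Q δ  ≈⟨ -‿cong (-‿cong (Q-cong (λ i → ℤₚ.+-comm (γ i) (δ i))) ≈-refl) ≈-refl ⟩
    Q (δ ⊕ γ) - Q γ - Q δ  ≡⟨ swap (Q (δ ⊕ γ)) (Q γ) (Q δ) ⟩
    Q (δ ⊕ γ) - Q δ - Q γ  ∎
    where
    swap : ∀ a b c → a - b - c ≡ a - c - b
    swap = solve 3 (λ a b c → a :- b :- c := a :- c :- b) refl

  bil-·ˡ : ∀ m γ δ → bil Q ((+ m) · γ) δ ≈ ι (+ m) * bil Q γ δ
  bil-·ˡ ℕ.zero γ δ = ≈-trans (bil-𝟘ˡ δ) (≈-reflexive (sym (ℚₚ.*-zeroˡ (bil Q γ δ))))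
  bil-·ˡ (ℕ.suc m) γ δ = begin
    bil Q ((+ ℕ.suc m) · γ) δ            ≈⟨ bil-respˡ δ (≈[]-reflexive q (λ i → unfold (+ m) (γ i))) ⟩
    bil Q (γ ⊕ ((+ m) · γ)) δ            ≈⟨ bil-additiveˡ γ ((+ m) · γ) δ ⟩
    bil Q γ δ + bil Q ((+ m) · γ) δ      ≈⟨ +-cong (≈-refl {bil Q γ δ}) (bil-·ˡ m γ δ) ⟩
    bil Q γ δ + ι (+ m) * bil Q γ δ    ≡⟨ fold (ι (+ m)) (bil Q γ δ) ⟩
    (1ℚ + ι (+ m)) * bil Q γ δ         ≡⟨ cong (_* bil Q γ δ) (sym (ι-+ (+ 1) (+ m))) ⟩
    ι (+ ℕ.suc m) * bil Q γ δ          ∎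
    where
    unfold : ∀ c x → (+ 1 ℤ.+ c) ℤ.* x ≡ x ℤ.+ c ℤ.* x
    unfold = solve-∀
    fold : ∀ c b → b + c * b ≡ (1ℚ + c) * b
    fold = solve 2 (λ c b → b :+ c :* b := (con 1ℚ :+ c) :* b) refl

  bil-q·ˡ≈0 : ∀ γ δ → bil Q ((+ q) · γ) δ ≈ 0ℚ
  bil-q·ˡ≈0 γ δ = ≈-trans (bil-respˡ δ qγ≈𝟘) (bil-𝟘ˡ δ)
    where
    qγ≈𝟘 : ((+ q) · γ) ≈[ q ] 𝟘
    qγ≈𝟘 i = subst (+ q ∣ℤ_) (sym (ℤₚ.+-identityʳ (+ q ℤ.* γ i)))
               (subst (q ℕ∣.∣_) (sym (ℤₚ.abs-* (+ q) (γ i))) (ℕ∣.m∣m*n ℤ.∣ γ i ∣))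

  q-bil≈0 : ∀ γ δ → ι (+ q) * bil Q γ δ ≈ 0ℚ
  q-bil≈0 γ δ = ≈-trans (≈-sym (bil-·ˡ q γ δ)) (bil-q·ˡ≈0 γ δ)

  2Q≈bil : ∀ γ → ι (+ 2) * Q γ ≈ bil Q γ γ
  2Q≈bil γ = begin
    ι (+ 2) * Q γ                 ≡⟨ four-minus-two (Q γ) ⟩
    ι (+ 4) * Q γ - (Q γ + Q γ)   ≈⟨ -‿cong (≈-sym (Q-quadratic (+ 2) γ)) ≈-refl ⟩
    Q ((+ 2) · γ) - (Q γ + Q γ)   ≈⟨ -‿cong (Q-cong (λ i → twice (γ i))) ≈-refl ⟩
    Q (γ ⊕ γ) - (Q γ + Q γ)       ≡⟨ cong (λ z → z - (Q γ + Q γ)) (Q-⊕ Q γ γ) ⟩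
    Q γ + Q γ + bil Q γ γ - (Q γ + Q γ) ≡⟨ cancel (Q γ + Q γ) (bil Q γ γ) ⟩
    bil Q γ γ                     ∎
    where
    four-minus-two : ∀ x → ι (+ 2) * x ≡ ι (+ 4) * x - (x + x)
    four-minus-two = solve 1 (λ x → con (ι (+ 2)) :* x := con (ι (+ 4)) :* x :- (x :+ x)) refl
    twice : ∀ x → + 2 ℤ.* x ≡ x ℤ.+ x
    twice = solve-∀
    cancel : ∀ a b → a + b - a ≡ b
    cancel = solve 2 (λ a b → a :+ b :- a := b) refl

  2q-Q≈0 : ∀ γ → ι (+ (2 ℕ.* q)) * Q γ ≈ 0ℚ
  2q-Q≈0 γ = begin
    ι (+ (2 ℕ.* q)) * Q γ          ≡⟨ cong (_* Q γ) (ι-pos-* 2 q) ⟩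
    ι (+ 2) * ι (+ q) * Q γ        ≡⟨ rearrange (ι (+ 2)) (ι (+ q)) (Q γ) ⟩
    ι (+ q) * (ι (+ 2) * Q γ)      ≈⟨ ι*-congˡ (+ q) (2Q≈bil γ) ⟩
    ι (+ q) * bil Q γ γ            ≈⟨ q-bil≈0 γ γ ⟩
    0ℚ                             ∎
    where
    rearrange : ∀ a b x → a * b * x ≡ b * (a * x)
    rearrange = solve 3 (λ a b x → a :* b :* x := b :* (a :* x)) refl

  bil-quadratic : ∀ a γ δ → bil Q (a · γ) (a · δ) ≈ ι (a ℤ.* a) * bil Q γ δ
  bil-quadratic a γ δ = begin
    Q ((a · γ) ⊕ (a · δ)) - Q (a · γ) - Q (a · δ)
      ≈⟨ -‿cong (-‿cong (Q-cong (λ i → distrib (γ i) (δ i))) ≈-refl) ≈-refl ⟩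
    Q (a · (γ ⊕ δ)) - Q (a · γ) - Q (a · δ)
      ≈⟨ -‿cong (-‿cong (Q-quadratic a (γ ⊕ δ)) (Q-quadratic a γ)) (Q-quadratic a δ) ⟩
    c * Q (γ ⊕ δ) - c * Q γ - c * Q δ              ≡⟨ factor c (Q (γ ⊕ δ)) (Q γ) (Q δ) ⟩
    c * bil Q γ δ                                  ∎
    where
    c : ℚ
    c = ι (a ℤ.* a)
    distrib : ∀ x y → a ℤ.* x ℤ.+ a ℤ.* y ≡ a ℤ.* (x ℤ.+ y)
    distrib x y = sym (ℤₚ.*-distribˡ-+ a x y)
    factor : ∀ c x y z → c * x - c * y - c * z ≡ c * (x - y - z)
    factor = solve 4 (λ c x y z → c :* x :- c :* y :- c :* z := c :* (x :- y :- z)) refl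

  Q-torsion : ∀ c a γ → 2 ℕ.* q ℕ∣.∣ c ℕ.* (a ℕ.* a) → ι (+ c) * Q ((+ a) · γ) ≈ 0ℚ
  Q-torsion c a γ 2q∣ca² =
    ≈-trans (ι*-congˡ (+ c) (Q-quadratic (+ a) γ)) (ι-square-annihilates c a 2q∣ca² (2q-Q≈0 γ))

  bil-torsion : ∀ c a γ δ → q ℕ∣.∣ c ℕ.* (a ℕ.* a) → ι (+ c) * bil Q ((+ a) · γ) ((+ a) · δ) ≈ 0ℚ
  bil-torsion c a γ δ q∣ca² =
    ≈-trans (ι*-congˡ (+ c) (bil-quadratic (+ a) γ δ)) (ι-square-annihilates c a q∣ca² (q-bil≈0 γ δ))

V : ℕ → Set
V N = Fin N → Bool

infixl 6 _⊻_
_⊻_ : ∀ {N} → V N → V N → V N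
(x ⊻ y) j = x j xor y j

unit : ∀ {N} → Fin N → V N
unit r j = does (r Fin.≟ j)

Nonzero : ∀ {N} → V N → Set
Nonzero z = ∃ λ j → z j ≡ true

ClosedUnder⊻ : ∀ {N} → (V N → Set) → Set
ClosedUnder⊻ P = ∀ x y → P x → P y → P (x ⊻ y)

≟-injective : ∀ {k m} {f : Fin k → Fin m} → (∀ {a b} → f a ≡ f b → a ≡ b) →
              ∀ a b → does (f a Fin.≟ f b) ≡ does (a Fin.≟ b)
≟-injective {f = f} f-inj a b with a Fin.≟ b
... | yes refl = dec-true (f a Fin.≟ f a) refl
... | no a≢b = dec-false (f a Fin.≟ f b) (a≢b ∘ f-inj)

-- The members restricted to the pivot columns form an identity matrix; so the
-- members are linearly independent and each nonempty sum of them is nonzero.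
record PivotFamily (N k : ℕ) : Set where
  field
    member : Fin k → V N
    pivot : Fin k → Fin N
    member-at-pivot : ∀ a c → member a (pivot c) ≡ does (a Fin.≟ c)

open PivotFamily

All : ∀ {N k} → (V N → Set) → PivotFamily N k → Set
All P F = ∀ a → P (member F a)

unitFamily : ∀ {N k} (f : Fin k → Fin N) → (∀ {a b} → f a ≡ f b → a ≡ b) → PivotFamily N k
unitFamily f f-inj = record
  { member = unit ∘ f
  ; pivot = f
  ; member-at-pivot = ≟-injective f-inj
  }

dropLast : ∀ {N k} → PivotFamily N (suc k) → PivotFamily N k
dropLast F = record
  { member = member F ∘ inject₁
  ; pivot = pivot F ∘ inject₁
  ; member-at-pivot = λ a c →
      trans (member-at-pivot F (inject₁ a) (inject₁ c)) (≟-injective Finₚ.inject₁-injective a c)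
  }

-- One step of Gaussian elimination: a member w failing R is added to every other
-- member failing R, and w with its pivot is dropped.
module Elimination {N : ℕ} (P : V N → Set) (P-⊻ : ClosedUnder⊻ P)
                   (R : V N → Set) (R? : ∀ x → Dec (R x))
                   (R-⊻ : ∀ {x y} → ¬ R x → ¬ R y → R (x ⊻ y)) where

  adjust : V N → V N → V N
  adjust w v with R? v
  ... | yes _ = v
  ... | no _ = v ⊻ w

  adjust-R : ∀ {w} → ¬ R w → ∀ v → R (adjust w v)
  adjust-R ¬Rw v with R? v
  ... | yes Rv = Rv
  ... | no ¬Rv = R-⊻ ¬Rv ¬Rw

  adjust-P : ∀ {w v} → P w → P v → P (adjust w v)
  adjust-P {w} {v} Pw Pv with R? v
  ... | yes _ = Pv
  ... | no _ = P-⊻ v w Pv Pw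

  adjust-outside-support : ∀ w v j → w j ≡ false → adjust w v j ≡ v j
  adjust-outside-support w v j wj≡false with R? v
  ... | yes _ = refl
  ... | no _ = trans (cong (v j xor_) wj≡false) (Boolₚ.xor-identityʳ (v j))

  eliminate : ∀ {k} → Fin (suc k) → PivotFamily N (suc k) → PivotFamily N k
  eliminate o F = record
    { member = λ a → adjust (member F o) (member F (punchIn o a))
    ; pivot = pivot F ∘ punchIn o
    ; member-at-pivot = λ a c → begin
        adjust (member F o) (member F (punchIn o a)) (pivot F (punchIn o c))
          ≡⟨ adjust-outside-support _ _ _ (o-off-pivot c) ⟩
        member F (punchIn o a) (pivot F (punchIn o c))
          ≡⟨ member-at-pivot F (punchIn o a) (punchIn o c) ⟩
        does (punchIn o a Fin.≟ punchIn o c)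
          ≡⟨ ≟-injective (Finₚ.punchIn-injective o _ _) a c ⟩
        does (a Fin.≟ c) ∎
    }
    where
    open ≡-Reasoning
    o-off-pivot : ∀ c → member F o (pivot F (punchIn o c)) ≡ false
    o-off-pivot c = trans (member-at-pivot F o (punchIn o c))
                          (dec-false (o Fin.≟ punchIn o c) (Finₚ.punchInᵢ≢i o c ∘ sym))

  shrink : ∀ {k} (F : PivotFamily N (suc k)) → All P F →
           Σ (PivotFamily N k) λ F' → All P F' × All R F'
  shrink {k} F PF with Finₚ.all? (R? ∘ member F)
  ... | yes RF = dropLast F , PF ∘ inject₁ , RF ∘ inject₁
  ... | no ¬RF with Finₚ.¬∀⟶∃¬ (suc k) (R ∘ member F) (R? ∘ member F) ¬RF
  ...   | o , ¬Ro = eliminate o F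
                  , (λ a → adjust-P (PF o) (PF (punchIn o a)))
                  , (λ a → adjust-R ¬Ro (member F (punchIn o a)))

-- An explicit witness that δ and μ are linearly independent over 𝔽₂.
Independent₂ : ∀ {N} → V N → V N → Set
Independent₂ δ μ = (∃ λ i → δ i ≡ true × μ i ≡ false) × Nonzero μ

record ℤ₄QuadraticForm (N : ℕ) : Set where
  field
    qf : V N → ℤ₄
    bf : V N → V N → ℤ₄
    qf-⊻ : ∀ x y → qf (x ⊻ y) ≡ qf x +₄ qf y +₄ bf x y
    bf-⊻ˡ : ∀ x y z → bf (x ⊻ y) z ≡ bf x z +₄ bf y z
    bf-sym : ∀ x y → bf x y ≡ bf y x
    bf-even : ∀ x y → bf x y +₄ bf x y ≡ 0₄

module ℤ₄QuadraticFormProperties {N : ℕ} (F : ℤ₄QuadraticForm N) where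
  open ℤ₄QuadraticForm F

  IsotropicVectorIn : (V N → Set) → Set
  IsotropicVectorIn P = Σ (V N) λ z → P z × qf z ≡ 0₄ × Nonzero z

  IsotropicOrthogonalPair : Set
  IsotropicOrthogonalPair = Σ (V N) λ δ → Σ (V N) λ μ →
    qf δ ≡ 0₄ × qf μ ≡ 0₄ × bf δ μ ≡ 0₄ × Independent₂ δ μ

  qf-⊻-of-2₄ : ∀ {x y} → qf x ≡ 2₄ → qf y ≡ 2₄ → qf (x ⊻ y) ≡ bf x y
  qf-⊻-of-2₄ {x} {y} qx qy = trans (qf-⊻ x y) (cong₂ (λ u v → u +₄ v +₄ bf x y) qx qy)

  isotropic-among-three-even : ∀ {P} → ClosedUnder⊻ P → (W : PivotFamily N 3) → All P W →
                               All (Even₄ ∘ qf) W → IsotropicVectorIn P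
  isotropic-among-three-even {P} P-⊻ W PW evenW = search (evenW 0F) (evenW 1F) (evenW 2F)
    where
    0F 1F 2F : Fin 3
    0F = zero
    1F = suc zero
    2F = suc (suc zero)
    w : Fin 3 → V N
    w = member W
    p : Fin 3 → Fin N
    p = pivot W
    at : ∀ a c → w a (p c) ≡ does (a Fin.≟ c)
    at = member-at-pivot W
    bf-parity : ∀ a b → Even₄ (bf (w a) (w b))
    bf-parity a b = c+c≡0⇒even _ (bf-even (w a) (w b))
    pair : ∀ {a b} → qf (w a) ≡ 2₄ → qf (w b) ≡ 2₄ → bf (w a) (w b) ≡ 0₄ →
           w a (p a) xor w b (p a) ≡ true → IsotropicVectorIn P
    pair {a} {b} qa qb bab nonzero =
      w a ⊻ w b , P-⊻ (w a) (w b) (PW a) (PW b) , trans (qf-⊻-of-2₄ qa qb) bab , p a , nonzero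
    triple : qf (w 0F) ≡ 2₄ → qf (w 1F) ≡ 2₄ → qf (w 2F) ≡ 2₄ →
             bf (w 0F) (w 1F) ≡ 2₄ → bf (w 0F) (w 2F) ≡ 2₄ → bf (w 1F) (w 2F) ≡ 2₄ →
             qf (w 0F ⊻ w 1F ⊻ w 2F) ≡ 0₄
    triple q₀ q₁ q₂ b₀₁ b₀₂ b₁₂ = begin
      qf (w 0F ⊻ w 1F ⊻ w 2F)                                ≡⟨ qf-⊻ (w 0F ⊻ w 1F) (w 2F) ⟩
      qf (w 0F ⊻ w 1F) +₄ qf (w 2F) +₄ bf (w 0F ⊻ w 1F) (w 2F)
        ≡⟨ cong₂ (λ u v → u +₄ qf (w 2F) +₄ v) (trans (qf-⊻-of-2₄ q₀ q₁) b₀₁) (bf-⊻ˡ (w 0F) (w 1F) (w 2F)) ⟩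
      2₄ +₄ qf (w 2F) +₄ (bf (w 0F) (w 2F) +₄ bf (w 1F) (w 2F))
        ≡⟨ cong₂ (λ u v → 2₄ +₄ u +₄ v) q₂ (cong₂ _+₄_ b₀₂ b₁₂) ⟩
      0₄                                                     ∎
      where open ≡-Reasoning
    search : Even₄ (qf (w 0F)) → Even₄ (qf (w 1F)) → Even₄ (qf (w 2F)) → IsotropicVectorIn P
    search (inj₁ q₀) _ _ = w 0F , PW 0F , q₀ , p 0F , at 0F 0F
    search _ (inj₁ q₁) _ = w 1F , PW 1F , q₁ , p 1F , at 1F 1F
    search _ _ (inj₁ q₂) = w 2F , PW 2F , q₂ , p 2F , at 2F 2F
    search (inj₂ q₀) (inj₂ q₁) (inj₂ q₂)
      with bf-parity 0F 1F | bf-parity 0F 2F | bf-parity 1F 2F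
    ... | inj₁ b₀₁ | _ | _ = pair q₀ q₁ b₀₁ (cong₂ _xor_ (at 0F 0F) (at 1F 0F))
    ... | _ | inj₁ b₀₂ | _ = pair q₀ q₂ b₀₂ (cong₂ _xor_ (at 0F 0F) (at 2F 0F))
    ... | _ | _ | inj₁ b₁₂ = pair q₁ q₂ b₁₂ (cong₂ _xor_ (at 1F 1F) (at 2F 1F))
    ... | inj₂ b₀₁ | inj₂ b₀₂ | inj₂ b₁₂ =
          w 0F ⊻ w 1F ⊻ w 2F , P-⊻ (w 0F ⊻ w 1F) (w 2F) (P-⊻ (w 0F) (w 1F) (PW 0F) (PW 1F)) (PW 2F) ,
          triple q₀ q₁ q₂ b₀₁ b₀₂ b₁₂ ,
          p 0F , cong₂ _xor_ (cong₂ _xor_ (at 0F 0F) (at 1F 0F)) (at 2F 0F)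

  qf-⊻-of-odd : ∀ {x y} → ¬ Even₄ (qf x) → ¬ Even₄ (qf y) → Even₄ (qf (x ⊻ y))
  qf-⊻-of-odd {x} {y} odd-x odd-y =
    subst Even₄ (sym (qf-⊻ x y)) (odd+odd+even _ _ _ odd-x odd-y (c+c≡0⇒even _ (bf-even x y)))

  bf-⊻-of-nonorthogonal : ∀ {x y z} → ¬ bf x z ≡ 0₄ → ¬ bf y z ≡ 0₄ → bf (x ⊻ y) z ≡ 0₄
  bf-⊻-of-nonorthogonal {x} {y} {z} bxz≢0 byz≢0 =
    trans (bf-⊻ˡ x y z) (cong₂ _+₄_ (≢0⇒2₄ (bf-even x z) bxz≢0) (≢0⇒2₄ (bf-even y z) byz≢0))
    where
    ≢0⇒2₄ : ∀ {c} → c +₄ c ≡ 0₄ → ¬ c ≡ 0₄ → c ≡ 2₄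
    ≢0⇒2₄ {c} c+c≡0 c≢0 with c+c≡0⇒even c c+c≡0
    ... | inj₁ c≡0 = ⊥-elim (c≢0 c≡0)
    ... | inj₂ c≡2 = c≡2

  isotropic-among-four : ∀ {P} → ClosedUnder⊻ P → (W : PivotFamily N 4) → All P W → IsotropicVectorIn P
  isotropic-among-four {P} P-⊻ W PW =
    let (W′ , PW′ , evenW′) = shrink W PW in isotropic-among-three-even P-⊻ W′ PW′ evenW′
    where open Elimination P P-⊻ (Even₄ ∘ qf) (even₄? ∘ qf) qf-⊻-of-odd

isotropic-orthogonal-pair : ∀ {N} → 6 ≤ N → (F : ℤ₄QuadraticForm N) →
                            ℤ₄QuadraticFormProperties.IsotropicOrthogonalPair F
isotropic-orthogonal-pair {suc N} (ℕ.s≤s 5≤N) F =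
  extend (isotropic-among-four (λ _ _ _ _ → tt) firstFour (λ _ → tt))
  where
  open ℤ₄QuadraticForm F
  open ℤ₄QuadraticFormProperties F
  4≤1+N : 4 ≤ suc N
  4≤1+N = ℕₚ.≤-trans (ℕₚ.n≤1+n 4) (ℕₚ.m≤n⇒m≤1+n 5≤N)
  firstFour : PivotFamily (suc N) 4
  firstFour = unitFamily (λ a → inject≤ a 4≤1+N) (Finₚ.inject≤-injective _ _ _ _)
  extend : IsotropicVectorIn (λ _ → ⊤) → IsotropicOrthogonalPair
  extend (δ , _ , qδ , i , δi) =
    let (W , avoidW , ⊥W) = shrink fiveAvoiding fiveAvoiding-avoids-i
        (μ , (μi , μ⊥δ) , qμ , μ≢0) = isotropic-among-four avoid-⊥-closed W (λ a → avoidW a , ⊥W a)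
    in δ , μ , qδ , qμ , trans (bf-sym δ μ) μ⊥δ , (i , δi , μi) , μ≢0
    where
    Avoids-i : V (suc N) → Set
    Avoids-i x = x i ≡ false
    ⊥δ : V (suc N) → Set
    ⊥δ x = bf x δ ≡ 0₄
    avoid-closed : ClosedUnder⊻ Avoids-i
    avoid-closed _ _ xi yi = cong₂ _xor_ xi yi
    avoid-⊥-closed : ClosedUnder⊻ (λ x → Avoids-i x × ⊥δ x)
    avoid-⊥-closed x y (xi , x⊥δ) (yi , y⊥δ) =
      avoid-closed x y xi yi , trans (bf-⊻ˡ x y δ) (cong₂ _+₄_ x⊥δ y⊥δ)
    fiveAvoiding : PivotFamily (suc N) 5
    fiveAvoiding = unitFamily (λ a → punchIn i (inject≤ a 5≤N))
                              (λ eq → Finₚ.inject≤-injective _ _ _ _ (Finₚ.punchIn-injective i _ _ eq))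
    fiveAvoiding-avoids-i : All Avoids-i fiveAvoiding
    fiveAvoiding-avoids-i a = dec-false (punchIn i _ Fin.≟ i) (Finₚ.punchInᵢ≢i i _)
    open Elimination Avoids-i avoid-closed ⊥δ (λ x → ≟0₄ (bf x δ)) bf-⊻-of-nonorthogonal

bit : Bool → ℤ
bit b = if b then + 1 else 0ℤ

bit-xor : ∀ a b → ℤ∣._∣_ (+ 2) (bit (a xor b) ℤ.- (bit a ℤ.+ bit b))
bit-xor true  true  = ℤ∣.divides (ℤ.- + 1) refl
bit-xor true  false = ℤ∣.divides 0ℤ refl
bit-xor false true  = ℤ∣.divides 0ℤ refl
bit-xor false false = ℤ∣.divides 0ℤ refl

module TwoTorsion {n s : ℕ} {Q : Vecℤ n → ℚ} (D : IsDiscriminantForm (2 ℕ.* s) n Q) where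
  open DiscriminantForm D

  embed : V n → Vecℤ n
  embed x = (+ s) · (bit ∘ x)

  embed-⊻ : ∀ x y → embed (x ⊻ y) ≈[ 2 ℕ.* s ] (embed x ⊕ embed y)
  embed-⊻ x y i with bit-xor (x i) (y i)
  ... | ℤ∣.divides k eq = ℤ∣.∣⇒∣ᵤ (ℤ∣.divides k (begin
    + s ℤ.* bit (x i xor y i) ℤ.- (+ s ℤ.* bit (x i) ℤ.+ + s ℤ.* bit (y i))
      ≡⟨ factor (+ s) (bit (x i xor y i)) (bit (x i)) (bit (y i)) ⟩
    + s ℤ.* (bit (x i xor y i) ℤ.- (bit (x i) ℤ.+ bit (y i)))
      ≡⟨ cong (+ s ℤ.*_) eq ⟩
    + s ℤ.* (k ℤ.* + 2)
      ≡⟨ regroup (+ s) k ⟩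
    k ℤ.* (+ 2 ℤ.* + s)
      ≡⟨ cong (k ℤ.*_) (sym (ℤₚ.pos-* 2 s)) ⟩
    k ℤ.* + (2 ℕ.* s) ∎))
    where
    open ≡-Reasoning
    factor : ∀ z u v w → z ℤ.* u ℤ.- (z ℤ.* v ℤ.+ z ℤ.* w) ≡ z ℤ.* (u ℤ.- (v ℤ.+ w))
    factor = solve-∀
    regroup : ∀ z k → z ℤ.* (k ℤ.* + 2) ≡ k ℤ.* (+ 2 ℤ.* z)
    regroup = solve-∀

  4Q≈0 : ∀ x → ι (+ 4) * Q (embed x) ≈ 0ℚ
  4Q≈0 x = Q-torsion 4 s (bit ∘ x) (ℕ∣.divides s (arith s))
    where
    arith : ∀ s → 4 ℕ.* (s ℕ.* s) ≡ s ℕ.* (2 ℕ.* (2 ℕ.* s))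
    arith = ℕ-solve-∀

  4bil≈0 : ∀ x y → ι (+ 4) * bil Q (embed x) (embed y) ≈ 0ℚ
  4bil≈0 x y = bil-torsion 4 s (bit ∘ x) (bit ∘ y) (ℕ∣.divides (2 ℕ.* s) (arith s))
    where
    arith : ∀ s → 4 ℕ.* (s ℕ.* s) ≡ (2 ℕ.* s) ℕ.* (2 ℕ.* s)
    arith = ℕ-solve-∀

  2bil≈0 : ∀ x y → ι (+ 2) * bil Q (embed x) (embed y) ≈ 0ℚ
  2bil≈0 x y = bil-torsion 2 s (bit ∘ x) (bit ∘ y) (ℕ∣.divides s (arith s))
    where
    arith : ∀ s → 2 ℕ.* (s ℕ.* s) ≡ s ℕ.* (2 ℕ.* s)
    arith = ℕ-solve-∀

  qf : V n → ℤ₄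
  qf x = proj₁ (quarter-class (Q (embed x)) (4Q≈0 x))

  qf-spec : ∀ x → Q (embed x) ≈ quarters (qf x)
  qf-spec x = proj₂ (quarter-class (Q (embed x)) (4Q≈0 x))

  bf : V n → V n → ℤ₄
  bf x y = proj₁ (quarter-class (bil Q (embed x) (embed y)) (4bil≈0 x y))

  bf-spec : ∀ x y → bil Q (embed x) (embed y) ≈ quarters (bf x y)
  bf-spec x y = proj₂ (quarter-class (bil Q (embed x) (embed y)) (4bil≈0 x y))

  form : ℤ₄QuadraticForm n
  form = record
    { qf = qf
    ; bf = bf
    ; qf-⊻ = λ x y → quarters-injective _ _ (begin
        quarters (qf (x ⊻ y))                            ≈⟨ ≈-sym (qf-spec (x ⊻ y)) ⟩
        Q (embed (x ⊻ y))                                ≈⟨ Q-resp (embed-⊻ x y) ⟩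
        Q (embed x ⊕ embed y)                            ≡⟨ Q-⊕ Q (embed x) (embed y) ⟩
        Q (embed x) + Q (embed y) + bil Q (embed x) (embed y)
          ≈⟨ +-cong (+-cong (qf-spec x) (qf-spec y)) (bf-spec x y) ⟩
        quarters (qf x) + quarters (qf y) + quarters (bf x y)
          ≈⟨ +-cong (≈-sym (quarters-+ (qf x) (qf y))) ≈-refl ⟩
        quarters (qf x +₄ qf y) + quarters (bf x y)      ≈⟨ ≈-sym (quarters-+ (qf x +₄ qf y) (bf x y)) ⟩
        quarters (qf x +₄ qf y +₄ bf x y)                ∎)
    ; bf-⊻ˡ = λ x y z → quarters-injective _ _ (begin
        quarters (bf (x ⊻ y) z)                          ≈⟨ ≈-sym (bf-spec (x ⊻ y) z) ⟩
        bil Q (embed (x ⊻ y)) (embed z)                  ≈⟨ bil-respˡ (embed z) (embed-⊻ x y) ⟩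
        bil Q (embed x ⊕ embed y) (embed z)              ≈⟨ bil-additiveˡ (embed x) (embed y) (embed z) ⟩
        bil Q (embed x) (embed z) + bil Q (embed y) (embed z)
          ≈⟨ +-cong (bf-spec x z) (bf-spec y z) ⟩
        quarters (bf x z) + quarters (bf y z)            ≈⟨ ≈-sym (quarters-+ (bf x z) (bf y z)) ⟩
        quarters (bf x z +₄ bf y z)                      ∎)
    ; bf-sym = λ x y → quarters-injective _ _ (begin
        quarters (bf x y)                                ≈⟨ ≈-sym (bf-spec x y) ⟩
        bil Q (embed x) (embed y)                        ≈⟨ bil-sym (embed x) (embed y) ⟩
        bil Q (embed y) (embed x)                        ≈⟨ bf-spec y x ⟩
        quarters (bf y x)                                ∎)
    ; bf-even = λ x y → quarters-injective _ _ (begin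
        quarters (bf x y +₄ bf x y)                      ≈⟨ quarters-+ (bf x y) (bf x y) ⟩
        quarters (bf x y) + quarters (bf x y)            ≈⟨ ≈-sym (+-cong (bf-spec x y) (bf-spec x y)) ⟩
        bil Q (embed x) (embed y) + bil Q (embed x) (embed y)
          ≡⟨ double (bil Q (embed x) (embed y)) ⟩
        ι (+ 2) * bil Q (embed x) (embed y)              ≈⟨ 2bil≈0 x y ⟩
        0ℚ                                               ≡⟨ sym quarters-0₄ ⟩
        quarters 0₄                                      ∎)
    }
    where
    open ≈-Reasoning
    double : ∀ b → b + b ≡ ι (+ 2) * b
    double = solve 1 (λ b → b :+ b := con (ι (+ 2)) :* b) refl

  2∣-of-2s∣ : ∀ .{{_ : ℕ.NonZero s}} c → + (2 ℕ.* s) ∣ℤ c ℤ.* + s → + 2 ∣ℤ c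
  2∣-of-2s∣ c 2s∣cs = ℕ∣.*-cancelʳ-∣ s (subst ((2 ℕ.* s) ℕ∣.∣_) (ℤₚ.abs-* c (+ s)) 2s∣cs)

  2s∣-of-2∣ : ∀ c t → + 2 ∣ℤ c → + (2 ℕ.* s) ∣ℤ c ℤ.* (+ s ℤ.* t)
  2s∣-of-2∣ c t 2∣c with ℤ∣.∣ᵤ⇒∣ {+ 2} {c} 2∣c
  ... | ℤ∣.divides k c≡2k = ℤ∣.∣⇒∣ᵤ (ℤ∣.divides (k ℤ.* t) (begin
    c ℤ.* (+ s ℤ.* t)              ≡⟨ cong (ℤ._* (+ s ℤ.* t)) c≡2k ⟩
    k ℤ.* + 2 ℤ.* (+ s ℤ.* t)      ≡⟨ regroup k (+ s) t ⟩
    k ℤ.* t ℤ.* (+ 2 ℤ.* + s)      ≡⟨ cong (k ℤ.* t ℤ.*_) (sym (ℤₚ.pos-* 2 s)) ⟩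
    k ℤ.* t ℤ.* + (2 ℕ.* s)        ∎))
    where
    open ≡-Reasoning
    regroup : ∀ k z t → k ℤ.* + 2 ℤ.* (z ℤ.* t) ≡ k ℤ.* t ℤ.* (+ 2 ℤ.* z)
    regroup = solve-∀

  qf≡0⇒isotropic : ∀ x → qf x ≡ 0₄ → Q (embed x) ≈ 0ℚ
  qf≡0⇒isotropic x qx = ≈-trans (qf-spec x) (≈-reflexive (trans (cong quarters qx) quarters-0₄))

  bf≡0⇒orthogonal : ∀ x y → bf x y ≡ 0₄ → bil Q (embed x) (embed y) ≈ 0ℚ
  bf≡0⇒orthogonal x y bxy = ≈-trans (bf-spec x y) (≈-reflexive (trans (cong quarters bxy) quarters-0₄))

  embed-independent : ∀ .{{_ : ℕ.NonZero s}} {δ μ} → Independent₂ δ μ →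
                      LinIndepMod (2 ℕ.* s) 2 (embed δ) (embed μ)
  embed-independent {δ} {μ} ((i , δi , μi) , (j , μj)) a b combination≈0 = 2∣a , 2∣b
    where
    combination : Fin n → ℤ
    combination k = a ℤ.* (+ s ℤ.* bit (δ k)) ℤ.+ b ℤ.* (+ s ℤ.* bit (μ k))
    2s∣combination : ∀ k → + (2 ℕ.* s) ∣ℤ combination k
    2s∣combination k = subst (+ (2 ℕ.* s) ∣ℤ_) (ℤₚ.+-identityʳ (combination k)) (combination≈0 k)
    at-i : ∀ a b z → a ℤ.* (z ℤ.* + 1) ℤ.+ b ℤ.* (z ℤ.* 0ℤ) ≡ a ℤ.* z
    at-i = solve-∀
    2∣a : + 2 ∣ℤ a
    2∣a = 2∣-of-2s∣ a (subst (+ (2 ℕ.* s) ∣ℤ_) combination-i (2s∣combination i))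
      where
      combination-i : combination i ≡ a ℤ.* + s
      combination-i = trans (cong₂ (λ u v → a ℤ.* (+ s ℤ.* bit u) ℤ.+ b ℤ.* (+ s ℤ.* bit v)) δi μi)
                            (at-i a b (+ s))
    2∣b : + 2 ∣ℤ b
    2∣b = 2∣-of-2s∣ b (ℤ∣.∣⇒∣ᵤ (ℤ∣.∣m+n∣m⇒∣n 2s∣combination-j 2s∣first-term))
      where
      first-term : ℤ
      first-term = a ℤ.* (+ s ℤ.* bit (δ j))
      2s∣first-term : ℤ∣._∣_ (+ (2 ℕ.* s)) first-term
      2s∣first-term = ℤ∣.∣ᵤ⇒∣ (2s∣-of-2∣ a (bit (δ j)) 2∣a)
      2s∣combination-j : ℤ∣._∣_ (+ (2 ℕ.* s)) (first-term ℤ.+ b ℤ.* + s)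
      2s∣combination-j = ℤ∣.∣ᵤ⇒∣ (subst (λ z → + (2 ℕ.* s) ∣ℤ (first-term ℤ.+ b ℤ.* z))
                                       (trans (cong (λ u → + s ℤ.* bit u) μj) (ℤₚ.*-identityʳ (+ s)))
                                       (2s∣combination j))

IsotropicPair : ∀ {n} → (Vecℤ n → ℚ) → (Vecℤ n → Vecℤ n → Set) → Set
IsotropicPair Q Independent = ∃₂ λ δ μ →
  (Q δ ≡ℚ/ℤ 0ℚ) × (Q μ ≡ℚ/ℤ 0ℚ) × (bil Q δ μ ≡ℚ/ℤ 0ℚ) × Independent δ μ

map-independence : ∀ {n} {Q : Vecℤ n → ℚ} {I J : Vecℤ n → Vecℤ n → Set} →
                   (∀ {δ μ} → I δ μ → J δ μ) → IsotropicPair Q I → IsotropicPair Q J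
map-independence f (δ , μ , Qδ , Qμ , δ⊥μ , independent) = δ , μ , Qδ , Qμ , δ⊥μ , f independent

isotropic-pair-trivial-group : ∀ {n} {Q : Vecℤ n → ℚ} → IsDiscriminantForm 1 n Q →
                               IsotropicPair Q (LinIndepMod 1 1)
isotropic-pair-trivial-group D =
  𝟘 , 𝟘 , integral-difference Q-𝟘 , integral-difference Q-𝟘 , integral-difference (bil-𝟘ˡ 𝟘) ,
  λ a b _ → ℕ∣.1∣ ℤ.∣ a ∣ , ℕ∣.1∣ ℤ.∣ b ∣
  where open DiscriminantForm D

isotropic-pair-even-order : ∀ {n s} {Q : Vecℤ n → ℚ} .{{_ : ℕ.NonZero s}} → 6 ≤ n →
                            IsDiscriminantForm (2 ℕ.* s) n Q → IsotropicPair Q (LinIndepMod (2 ℕ.* s) 2)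
isotropic-pair-even-order {s = s} 6≤n D =
  let (δ , μ , qδ , qμ , bδμ , independent) = isotropic-orthogonal-pair 6≤n form in
  embed δ , embed μ ,
  integral-difference (qf≡0⇒isotropic δ qδ) , integral-difference (qf≡0⇒isotropic μ qμ) ,
  integral-difference (bf≡0⇒orthogonal δ μ bδμ) , embed-independent independent
  where open TwoTorsion {s = s} D

isotropic-pair-of-units : ∀ {n s} {Q : Vecℤ n → ℚ} .{{_ : ℕ.NonZero s}} → 2 ≤ n →
                          2 ℕ.* (2 ℕ.* s) ℕ∣.∣ s ℕ.* s →
                          IsDiscriminantForm (2 ℕ.* s) n Q → IsotropicPair Q (LinIndepMod (2 ℕ.* s) 2)
isotropic-pair-of-units {suc (suc n)} {s} {Q} (ℕ.s≤s (ℕ.s≤s ℕ.z≤n)) 2q∣s² D =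
  embed ε₀ , embed ε₁ , integral-difference (isotropic ε₀) , integral-difference (isotropic ε₁) ,
  integral-difference orthogonal , embed-independent ((zero , refl , refl) , (suc zero , refl))
  where
  open TwoTorsion {s = s} D
  open DiscriminantForm D
  ε₀ ε₁ : V (suc (suc n))
  ε₀ = unit zero
  ε₁ = unit (suc zero)
  1·s² : ∀ {m} → m ℕ∣.∣ s ℕ.* s → m ℕ∣.∣ 1 ℕ.* (s ℕ.* s)
  1·s² {m} = subst (m ℕ∣.∣_) (sym (ℕₚ.*-identityˡ (s ℕ.* s)))
  q∣s² : 2 ℕ.* s ℕ∣.∣ s ℕ.* s
  q∣s² = ℕ∣.∣-trans (ℕ∣.n∣m*n 2) 2q∣s²
  isotropic : ∀ x → Q (embed x) ≈ 0ℚ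
  isotropic x = ≈-trans (≈-reflexive (sym (ℚₚ.*-identityˡ (Q (embed x)))))
                        (Q-torsion 1 s (bit ∘ x) (1·s² 2q∣s²))
  orthogonal : bil Q (embed ε₀) (embed ε₁) ≈ 0ℚ
  orthogonal = ≈-trans (≈-reflexive (sym (ℚₚ.*-identityˡ (bil Q (embed ε₀) (embed ε₁)))))
                       (bil-torsion 1 s (bit ∘ ε₀) (bit ∘ ε₁) (1·s² q∣s²))

16t∣[4t]² : ∀ t → 2 ℕ.* (2 ℕ.* (2 ℕ.* (2 ℕ.* t))) ℕ∣.∣ (2 ℕ.* (2 ℕ.* t)) ℕ.* (2 ℕ.* (2 ℕ.* t))
16t∣[4t]² t = ℕ∣.divides t (arith t)
  where
  arith : ∀ t → (2 ℕ.* (2 ℕ.* t)) ℕ.* (2 ℕ.* (2 ℕ.* t)) ≡ t ℕ.* (2 ℕ.* (2 ℕ.* (2 ℕ.* (2 ℕ.* t))))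
  arith = ℕ-solve-∀

lemma6p10 : (e n : ℕ) → (e ≡ 1 ⊎ e ≡ 2 → 7 ≤ n) → (3 ≤ e → 3 ≤ n) →
    (Q : Vecℤ n → ℚ) → IsDiscriminantForm (2 ^ e) n Q →
    ∃₂ λ (δ μ : Vecℤ n) →
      (Q δ ≡ℚ/ℤ 0ℚ) × (Q μ ≡ℚ/ℤ 0ℚ) × (bil Q δ μ ≡ℚ/ℤ 0ℚ) ×
      (LinIndepMod (2 ^ e) 2 δ μ ⊎ LinIndepMod (2 ^ e) (2 ^ e) δ μ)
lemma6p10 0 n _ _ Q D = map-independence {Q = Q} inj₂ (isotropic-pair-trivial-group D)
lemma6p10 1 n n≥7 _ Q D =
  map-independence {Q = Q} inj₁ (isotropic-pair-even-order {s = 1} (ℕₚ.<⇒≤ (n≥7 (inj₁ refl))) D)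
lemma6p10 2 n n≥7 _ Q D =
  map-independence {Q = Q} inj₁ (isotropic-pair-even-order {s = 2} (ℕₚ.<⇒≤ (n≥7 (inj₂ refl))) D)
lemma6p10 (suc (suc (suc d))) n _ n≥3 Q D =
  map-independence {Q = Q} inj₁
    (isotropic-pair-of-units {s = 2 ^ (2 ℕ.+ d)} {{ℕₚ.m^n≢0 2 (2 ℕ.+ d)}}
       (ℕₚ.<⇒≤ (n≥3 (ℕ.s≤s (ℕ.s≤s (ℕ.s≤s ℕ.z≤n))))) (16t∣[4t]² (2 ^ d)) D)
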